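{- Let $k\ge1$, $n\ge k+2$, $w=n-k-2$. Let $F=(d_{i,j})$ be the frieze associated with an equation in $\mathcal{E}_{k+1,n}$ and $\mathcal{G}(F)=(d'_{i,j})$ the frieze associated with its Gale dual equation in $\mathcal{E}_{w+1,n}$. For $i\in\mathbb{Z}$ let $M^{(i)}_F$ be the $(k+1)\times n$ matrix with entry $(r,c)$ ($0\le r\le k$, $1\le c\le n$) equal to $d_{i+r,i+c-2}$ if $r+1\le c\le r+w+2$ and $0$ otherwise, and for $j\in\mathbb{Z}$ let $M^{(j)}_{\mathcal{G}(F)}$ be the $(w+1)\times n$ matrix with entry $(r,c)$ ($0\le r\le w$) equal to $d'_{j+r,j+c-2}$ if $r+1\le c\le r+k+2$ and $0$ otherwise. If $i-j\equiv w+1 \pmod n$, then $M^{(i)}_F\,D\,(M^{(j)}_{\mathcal{G}(F)})^T=0$, where $D=\mathrm{diag}(1,-1,1,\dots,(-1)^{n-1})$.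
   Context: For $m\ge0$, $\mathcal{E}_{m+1,n}$ is the set of difference equations $V_i=a_i^1V_{i-1}-\cdots+(-1)^{m-1}a_i^mV_{i-m}+(-1)^mV_{i-m-1}$ with real $n$-periodic coefficients such that every solution satisfies $V_{i+n}=(-1)^mV_i$. The frieze associated with an equation of order $m+1$ is the array $d_{i,j}:=V_j$ ($i-m-1\le j\le i+(n-m-2)+m$), where $(V_s)$ is the solution with $V_{i-m-1}=\dots=V_{i-2}=0$, $V_{i-1}=1$. The Gale dual of an equation in $\mathcal{E}_{k+1,n}$ with associated frieze $(d_{i,j})$ is the equation $W_i=\alpha_i^1W_{i-1}-\cdots+(-1)^{w-1}\alpha_i^wW_{i-w}+(-1)^wW_{i-w-1}$, $\alpha_i^j:=d_{i+1,w+i-j+1}$, which lies in $\mathcal{E}_{w+1,n}$. -}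

module Defs where

open import Level using (Level; _⊔_)
open import Algebra.Bundles using (CommutativeRing)
open import Data.Nat as ℕ using (ℕ; zero; suc; _∸_; _≤?_)
open import Data.Integer as ℤ using (ℤ; +_; -[1+_])
open import Data.Bool using (Bool; true; false; if_then_else_; _∧_)
open import Data.Product using (_×_)
open import Relation.Nullary.Decidable using (⌊_⌋)

-- All definitions are relative to a commutative ring R of coefficients
-- (the paper uses ℝ).
module Frieze {c ℓ : Level} (R : CommutativeRing c ℓ) where
  open CommutativeRing R

  sgn : ℕ → Carrier
  sgn zero    = 1#
  sgn (suc m) = - sgn m

  sum1 : ℕ → (ℕ → Carrier) → Carrier
  sum1 zero    f = 0#
  sum1 (suc m) f = sum1 m f + f (suc m)

  -- Coefficients: a i j = a_i^j  (only 1 ≤ j ≤ m is relevant)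
  Coeffs : Set c
  Coeffs = ℤ → ℕ → Carrier

  rhs : ℕ → Coeffs → (ℤ → Carrier) → ℤ → Carrier
  rhs m a V i =
    sum1 m (λ j → sgn (j ∸ 1) * a i j * V (i ℤ.- + j)) + sgn m * V (i ℤ.- + suc m)

  IsSolution : ℕ → Coeffs → (ℤ → Carrier) → Set ℓ
  IsSolution m a V = ∀ i → V i ≈ rhs m a V i

  -- The equation of order m+1 with coefficients a lies in E_{m+1,n}
  InE : ℕ → ℕ → Coeffs → Set (c ⊔ ℓ)
  InE m n a =
    (∀ i j → 1 ℕ.≤ j → j ℕ.≤ m → a (i ℤ.+ + n) j ≈ a i j)
    × (∀ (V : ℤ → Carrier) → IsSolution m a V → ∀ i → V (i ℤ.+ + n) ≈ sgn m * V i)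

  -- Forward computation of the solution V with V_{i-m-1} = … = V_{i-2} = 0, V_{i-1} = 1:
  -- state m a i t s = V_{i-1+t-s}   (for s ≤ m)
  state : ℕ → Coeffs → ℤ → ℕ → ℕ → Carrier
  state m a i zero    zero    = 1#
  state m a i zero    (suc s) = 0#
  state m a i (suc t) zero    =
    sum1 m (λ j → sgn (j ∸ 1) * a (i ℤ.+ + t) j * state m a i t (j ∸ 1))
      + sgn m * state m a i t m
  state m a i (suc t) (suc s) = state m a i t s

  -- frieze entry d_{i,j} = V_j; for j ≥ i-1 computed forward,
  -- for j < i-1 it is 0 (correct on the frieze's range i-m-1 ≤ j ≤ i-2).
  frieze : ℕ → Coeffs → ℤ → ℤ → Carrier
  frieze m a i j with j ℤ.- (i ℤ.- + 1)
  ... | + t      = state m a i t 0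
  ... | -[1+ _ ] = 0#

  galeCoeffs : ℕ → Coeffs → ℕ → Coeffs
  galeCoeffs k a w i j = frieze k a (i ℤ.+ + 1) (+ w ℤ.+ i ℤ.- + j ℤ.+ + 1)

  band : ℕ → ℕ → ℕ → Carrier → Carrier
  band lo hi col x = if ⌊ lo ≤? col ⌋ ∧ ⌊ col ≤? hi ⌋ then x else 0#

  -- M^{(i)} for a frieze d of an order-(m+1) equation with companion width p
  -- (p = w for F, p = k for G(F)); entry (r , col), 0 ≤ r, 1 ≤ col ≤ n:
  --   d_{i+r, i+col-2} if r+1 ≤ col ≤ r+p+2, else 0
  friezeMatrix : (ℤ → ℤ → Carrier) → ℕ → ℤ → ℕ → ℕ → Carrier
  friezeMatrix d p i r col =
    band (suc r) (r ℕ.+ p ℕ.+ 2) col (d (i ℤ.+ + r) (i ℤ.+ + col ℤ.- + 2))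

  -- entry (r , r') of  M D N^T  with D = diag(1,-1,…,(-1)^{n-1}), columns 1..n
  prodEntry : ℕ → (ℕ → ℕ → Carrier) → (ℕ → ℕ → Carrier) → ℕ → ℕ → Carrier
  prodEntry n M N r r' = sum1 n (λ col → M r col * sgn (col ∸ 1) * N r' col)

-- A row of the frieze F is a window 1, d, …, d, 1, 0, …, 0 of a solution: the periodicity
-- V_{p+n} = (-1)^k V_p of solutions carries the initial conditions 0, …, 0, 1 of the row to its
-- last k+1 entries.  Using this, an induction along a row shows that the rows of the Gale dual
-- frieze are the coefficient vectors of the original equation read backwards,
-- d'_{τ,τ-1+X} = a_{τ-1}^{k+1-X} (with a^0 = a^{k+1} = 1, and 0 for X > k+1).  An entry of
-- M_F D M_{G(F)}^T therefore pairs a window of a solution with a coefficient vector, and is,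
-- up to sign, the left-hand side of  Σ_l (-1)^l a_p^l V_{p-l} = 0  at a single index p.

module Submission where

open import Defs
open import Level using (Level)
open import Algebra.Bundles using (CommutativeRing)
open import Data.Nat as ℕ using (ℕ; _∸_; zero; suc; z≤n; s≤s)
open import Data.Integer as ℤ using (ℤ; +_; -[1+_])
open import Data.Product using (∃; _,_; proj₁; proj₂)
open import Relation.Binary.PropositionalEquality as P using (_≡_)
import Data.Nat.Properties as ℕP
import Data.Integer.Properties as ℤP
open import Data.Integer.Tactic.RingSolver using (solve-∀)
import Data.Nat.Tactic.RingSolver as ℕSolver
open import Data.Empty using (⊥-elim)
open import Relation.Nullary.Decidable using (⌊_⌋; yes; no)
open import Data.Bool using (if_then_else_)
open import Function using (_$_)
import Algebra.Solver.CommutativeMonoid as CMSolver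

module GaleDuality {c ℓ : Level} (R : CommutativeRing c ℓ) where
  open CommutativeRing R hiding (zero)
  open Frieze R
  open import Relation.Binary.Reasoning.Setoid setoid
  open import Algebra.Properties.Ring ring using (-‿distribˡ-*; -‿distribʳ-*)
  open import Algebra.Properties.AbelianGroup +-abelianGroup
    using (⁻¹-involutive; ⁻¹-∙-comm; ε⁻¹≈ε; xyx⁻¹≈y; x∙y⁻¹≈ε⇒x≈y)

  sgn-+ : ∀ m n → sgn (m ℕ.+ n) ≈ sgn m * sgn n
  sgn-+ zero    n = sym (*-identityˡ _)
  sgn-+ (suc m) n = trans (-‿cong (sgn-+ m n)) (-‿distribˡ-* _ _)

  sgn-square : ∀ m → sgn m * sgn m ≈ 1#
  sgn-square zero    = *-identityˡ _
  sgn-square (suc m) = begin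
    - sgn m * - sgn m     ≈⟨ -‿distribˡ-* _ _ ⟨
    - (sgn m * - sgn m)   ≈⟨ -‿cong (-‿distribʳ-* _ _) ⟨
    - - (sgn m * sgn m)   ≈⟨ ⁻¹-involutive _ ⟩
    sgn m * sgn m         ≈⟨ sgn-square m ⟩
    1#                    ∎

  sgn-complement : ∀ x y {z} → x ℕ.+ y ≡ z → sgn z * sgn x ≈ sgn y
  sgn-complement x y P.refl = begin
    sgn (x ℕ.+ y) * sgn x   ≈⟨ *-congʳ (sgn-+ x y) ⟩
    sgn x * sgn y * sgn x   ≈⟨ *-congʳ (*-comm _ _) ⟩
    sgn y * sgn x * sgn x   ≈⟨ *-assoc _ _ _ ⟩
    sgn y * (sgn x * sgn x) ≈⟨ *-congˡ (sgn-square x) ⟩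
    sgn y * 1#              ≈⟨ *-identityʳ _ ⟩
    sgn y                   ∎

  sgn-*-≈0 : ∀ m {x} → sgn m * x ≈ 0# → x ≈ 0#
  sgn-*-≈0 m {x} h = begin
    x                    ≈⟨ *-identityˡ x ⟨
    1# * x               ≈⟨ *-congʳ (sgn-square m) ⟨
    sgn m * sgn m * x    ≈⟨ *-assoc _ _ _ ⟩
    sgn m * (sgn m * x)  ≈⟨ *-congˡ h ⟩
    sgn m * 0#           ≈⟨ zeroʳ _ ⟩
    0#                   ∎

  -‿distribˡ-*-* : ∀ x y z → - x * y * z ≈ - (x * y * z)
  -‿distribˡ-*-* x y z = trans (*-congʳ (sym (-‿distribˡ-* x y))) (sym (-‿distribˡ-* _ z))

  *-zero-middle : ∀ {x y z} → y ≈ 0# → x * y * z ≈ 0#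
  *-zero-middle {x} {y} {z} y≈0 = trans (*-congʳ (trans (*-congˡ y≈0) (zeroʳ x))) (zeroˡ z)

  *-zero-last : ∀ {x y z} → z ≈ 0# → x * y * z ≈ 0#
  *-zero-last {x} {y} z≈0 = trans (*-congˡ z≈0) (zeroʳ (x * y))

  xy∙z∙w≈x∙[yz∙w] : ∀ x y z w → x * y * z * w ≈ x * (y * z * w)
  xy∙z∙w≈x∙[yz∙w] = solve 4 (λ x y z w → ((x ⊕ y) ⊕ z) ⊕ w ⊜ x ⊕ ((y ⊕ z) ⊕ w)) refl
    where open CMSolver *-commutativeMonoid using (solve; _⊜_; _⊕_)

  xy∙z∙w≈x∙[yw∙z] : ∀ x y z w → x * y * z * w ≈ x * (y * w * z)
  xy∙z∙w≈x∙[yw∙z] = solve 4 (λ x y z w → ((x ⊕ y) ⊕ z) ⊕ w ⊜ x ⊕ ((y ⊕ w) ⊕ z)) refl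
    where open CMSolver *-commutativeMonoid using (solve; _⊜_; _⊕_)

  x∙yz∙w≈y∙[zw∙x] : ∀ x y z w → x * (y * z) * w ≈ y * (z * w * x)
  x∙yz∙w≈y∙[zw∙x] = solve 4 (λ x y z w → (x ⊕ (y ⊕ z)) ⊕ w ⊜ y ⊕ ((z ⊕ w) ⊕ x)) refl
    where open CMSolver *-commutativeMonoid using (solve; _⊜_; _⊕_)

  sum1-cong : ∀ m {f g : ℕ → Carrier} → (∀ j → 1 ℕ.≤ j → j ℕ.≤ m → f j ≈ g j) →
              sum1 m f ≈ sum1 m g
  sum1-cong zero    h = refl
  sum1-cong (suc m) h =
    +-cong (sum1-cong m (λ j p q → h j p (ℕP.m≤n⇒m≤1+n q))) (h (suc m) (s≤s z≤n) ℕP.≤-refl)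

  sum1-zero : ∀ m {f : ℕ → Carrier} → (∀ j → 1 ℕ.≤ j → j ℕ.≤ m → f j ≈ 0#) → sum1 m f ≈ 0#
  sum1-zero m {f} h = trans (sum1-cong m h) (sum1-const0 m)
    where
    sum1-const0 : ∀ m → sum1 m (λ _ → 0#) ≈ 0#
    sum1-const0 zero    = refl
    sum1-const0 (suc m) = trans (+-identityʳ _) (sum1-const0 m)

  sum1-unfoldˡ : ∀ m (f : ℕ → Carrier) → sum1 (suc m) f ≈ f 1 + sum1 m (λ j → f (suc j))
  sum1-unfoldˡ zero    f = trans (+-identityˡ _) (sym (+-identityʳ _))
  sum1-unfoldˡ (suc m) f = trans (+-congʳ (sum1-unfoldˡ m f)) (+-assoc _ _ _)

  sum1-split : ∀ m n (f : ℕ → Carrier) →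
               sum1 (m ℕ.+ n) f ≈ sum1 m f + sum1 n (λ j → f (m ℕ.+ j))
  sum1-split zero    n f = sym (+-identityˡ _)
  sum1-split (suc m) n f = begin
    sum1 (suc (m ℕ.+ n)) f
      ≈⟨ sum1-unfoldˡ (m ℕ.+ n) f ⟩
    f 1 + sum1 (m ℕ.+ n) (λ j → f (suc j))
      ≈⟨ +-congˡ (sum1-split m n (λ j → f (suc j))) ⟩
    f 1 + (sum1 m (λ j → f (suc j)) + sum1 n (λ j → f (suc m ℕ.+ j)))
      ≈⟨ +-assoc _ _ _ ⟨
    f 1 + sum1 m (λ j → f (suc j)) + sum1 n (λ j → f (suc m ℕ.+ j))
      ≈⟨ +-congʳ (sum1-unfoldˡ m f) ⟨
    sum1 (suc m) f + sum1 n (λ j → f (suc m ℕ.+ j)) ∎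

  sum1-reverse : ∀ m (f : ℕ → Carrier) → sum1 m f ≈ sum1 m (λ j → f (suc m ∸ j))
  sum1-reverse zero    f = refl
  sum1-reverse (suc m) f = begin
    sum1 m f + f (suc m)                        ≈⟨ +-comm _ _ ⟩
    f (suc m) + sum1 m f                        ≈⟨ +-congˡ (sum1-reverse m f) ⟩
    f (suc m) + sum1 m (λ j → f (suc m ∸ j))    ≈⟨ sum1-unfoldˡ m _ ⟨
    sum1 (suc m) (λ j → f (suc (suc m) ∸ j))    ∎

  sum1-neg : ∀ m (f : ℕ → Carrier) → sum1 m (λ j → - f j) ≈ - sum1 m f
  sum1-neg zero    f = sym ε⁻¹≈ε
  sum1-neg (suc m) f = trans (+-congʳ (sum1-neg m f)) (⁻¹-∙-comm _ _)

  sum1-*ˡ : ∀ m x (f : ℕ → Carrier) → sum1 m (λ j → x * f j) ≈ x * sum1 m f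
  sum1-*ˡ zero    x f = sym (zeroʳ x)
  sum1-*ˡ (suc m) x f = trans (+-congʳ (sum1-*ˡ m x f)) (sym (distribˡ _ _ _))

  sum1-restrict : ∀ a b c (f : ℕ → Carrier) →
    (∀ j → 1 ℕ.≤ j → j ℕ.≤ a → f j ≈ 0#) →
    (∀ j → 1 ℕ.≤ j → j ℕ.≤ c → f (a ℕ.+ b ℕ.+ j) ≈ 0#) →
    sum1 (a ℕ.+ b ℕ.+ c) f ≈ sum1 b (λ j → f (a ℕ.+ j))
  sum1-restrict a b c f before after = begin
    sum1 (a ℕ.+ b ℕ.+ c) f
      ≈⟨ sum1-split (a ℕ.+ b) c f ⟩
    sum1 (a ℕ.+ b) f + sum1 c (λ j → f (a ℕ.+ b ℕ.+ j))
      ≈⟨ +-cong (sum1-split a b f) (sum1-zero c after) ⟩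
    sum1 a f + sum1 b (λ j → f (a ℕ.+ j)) + 0#
      ≈⟨ +-identityʳ _ ⟩
    sum1 a f + sum1 b (λ j → f (a ℕ.+ j))
      ≈⟨ +-congʳ (sum1-zero a before) ⟩
    0# + sum1 b (λ j → f (a ℕ.+ j))
      ≈⟨ +-identityˡ _ ⟩
    sum1 b (λ j → f (a ℕ.+ j)) ∎

  -- Rows of a frieze

  delay : (ℕ → Carrier) → ℕ → ℕ → Carrier
  delay f X       zero    = f X
  delay f zero    (suc Y) = 0#
  delay f (suc X) (suc Y) = delay f X Y

  delay-at : ∀ f {X} Y v → Y ℕ.+ v ≡ X → delay f X Y ≡ f v
  delay-at f zero    v P.refl = P.refl
  delay-at f (suc Y) v P.refl = delay-at f Y v P.refl

  delay-below : ∀ f {X Y} → X ℕ.< Y → delay f X Y ≡ 0#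
  delay-below f {zero}  {suc Y} _       = P.refl
  delay-below f {suc X} {suc Y} (s≤s p) = delay-below f p

  delay-diff : ∀ f X Y X′ Y′ → X ℕ.+ Y′ ≡ X′ ℕ.+ Y → delay f X Y ≡ delay f X′ Y′
  delay-diff f (suc X) (suc Y) X′ Y′ e =
    delay-diff f X Y X′ Y′ (ℕP.suc-injective (P.trans e (ℕP.+-suc X′ Y)))
  delay-diff f X zero (suc X′) (suc Y′) e =
    delay-diff f X zero X′ Y′ (ℕP.suc-injective (P.trans (P.sym (ℕP.+-suc X Y′)) e))
  delay-diff f zero (suc Y) (suc X′) (suc Y′) e =
    delay-diff f zero (suc Y) X′ Y′ (ℕP.suc-injective e)
  delay-diff f X zero X′ zero e =
    P.cong f (P.trans (P.sym (ℕP.+-identityʳ X)) (P.trans e (ℕP.+-identityʳ X′)))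
  delay-diff f X zero zero (suc Y′) e = ⊥-elim (ℕP.m+1+n≢0 X e)
  delay-diff f zero (suc Y) X′ zero e = ⊥-elim (ℕP.m+1+n≢0 X′ (P.sym e))
  delay-diff f zero (suc Y) zero (suc Y′) e = P.refl

  -- row m a σ t = d_{σ,σ-1+t}
  row : ℕ → Coeffs → ℤ → ℕ → Carrier
  row m a σ t = state m a σ t 0

  state≡delay : ∀ m a σ X Y → state m a σ X Y ≡ delay (row m a σ) X Y
  state≡delay m a σ X       zero    = P.refl
  state≡delay m a σ zero    (suc Y) = P.refl
  state≡delay m a σ (suc X) (suc Y) = state≡delay m a σ X Y

  state-diff : ∀ m a σ X Y X′ Y′ → X ℕ.+ Y′ ≡ X′ ℕ.+ Y →
               state m a σ X Y ≡ state m a σ X′ Y′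
  state-diff m a σ X Y X′ Y′ e =
    P.trans (state≡delay m a σ X Y)
            (P.trans (delay-diff (row m a σ) X Y X′ Y′ e) (P.sym (state≡delay m a σ X′ Y′)))

  state-below : ∀ m a σ {X Y} → X ℕ.< Y → state m a σ X Y ≡ 0#
  state-below m a σ {X} {Y} X<Y =
    P.trans (state≡delay m a σ X Y) (delay-below (row m a σ) X<Y)

  nonneg-diff : ∀ {t X Y} → + t ≡ + X ℤ.- + Y → Y ℕ.+ t ≡ X
  nonneg-diff {t} {X} {Y} eq =
    P.sym (ℤP.+-injective (P.trans (lemma (+ X) (+ Y))
                                   (P.trans (P.cong (λ z → + Y ℤ.+ z) (P.sym eq)) (P.sym (ℤP.pos-+ Y t)))))
    where
    lemma : ∀ x y → x ≡ y ℤ.+ (x ℤ.- y)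
    lemma = solve-∀

  neg-diff : ∀ {q X Y} → -[1+ q ] ≡ + X ℤ.- + Y → X ℕ.+ suc q ≡ Y
  neg-diff {q} {X} {Y} eq =
    ℤP.+-injective (P.trans (ℤP.pos-+ X (suc q)) (P.trans (P.cong (λ z → + X ℤ.- z) eq) (lemma (+ X) (+ Y))))
    where
    lemma : ∀ x y → x ℤ.- (x ℤ.- y) ≡ y
    lemma = solve-∀

  frieze≡state : ∀ m a σ p X Y → p ℤ.- (σ ℤ.- + 1) ≡ + X ℤ.- + Y →
                 frieze m a σ p ≡ state m a σ X Y
  frieze≡state m a σ p X Y eq with p ℤ.- (σ ℤ.- + 1)
  ... | + t      = state-diff m a σ t 0 X Y
                     (P.trans (ℕP.+-comm t Y) (P.trans (nonneg-diff eq) (P.sym (ℕP.+-identityʳ X))))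
  ... | -[1+ q ] = P.sym (state-below m a σ (P.subst (X ℕ.<_) (neg-diff eq) (ℕP.m<m+n X (s≤s z≤n))))

  -- (1, a¹, …, aᵐ, 1), so that the equation reads  Σ_{l=0}^{m+1} (-1)^l a^l V_{i-l} = 0.
  padded : ℕ → (ℕ → Carrier) → ℕ → Carrier
  padded m A zero    = 1#
  padded m A (suc l) = if ⌊ suc l ℕ.≤? m ⌋ then A (suc l) else 1#

  padded-inner : ∀ m A {l} → 1 ℕ.≤ l → l ℕ.≤ m → padded m A l ≡ A l
  padded-inner m A {suc l} _ l≤m with suc l ℕ.≤? m
  ... | yes _   = P.refl
  ... | no l≰m = ⊥-elim (l≰m l≤m)

  padded-last : ∀ m A → padded m A (suc m) ≡ 1#
  padded-last m A with suc m ℕ.≤? m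
  ... | yes m<m = ⊥-elim (ℕP.<-irrefl P.refl m<m)
  ... | no _    = P.refl

  padded-cong : ∀ m {A B} → (∀ l → 1 ℕ.≤ l → l ℕ.≤ m → A l ≈ B l) →
                ∀ l → padded m A l ≈ padded m B l
  padded-cong m h zero = refl
  padded-cong m h (suc l) with suc l ℕ.≤? m
  ... | yes l≤m = h (suc l) (s≤s z≤n) l≤m
  ... | no _    = refl

  state-recurrence : ∀ m a σ T →
    sum1 (suc (suc m)) (λ j → sgn (j ∸ 1) * padded m (a (σ ℤ.+ + T)) (j ∸ 1) * state m a σ (suc T) (j ∸ 1))
      ≈ 0#
  state-recurrence m a σ T = begin
    sum1 (suc m) f + f (suc (suc m))          ≈⟨ +-cong (sum1-unfoldˡ m f) last ⟩
    f 1 + sum1 m (λ j → f (suc j)) + - x     ≈⟨ +-congʳ (+-cong first middle) ⟩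
    S + x + - S + - x                        ≈⟨ +-congʳ (xyx⁻¹≈y S x) ⟩
    x + - x                                  ≈⟨ -‿inverseʳ x ⟩
    0#                                       ∎
    where
    A : ℕ → Carrier
    A = a (σ ℤ.+ + T)
    f g : ℕ → Carrier
    f j = sgn (j ∸ 1) * padded m A (j ∸ 1) * state m a σ (suc T) (j ∸ 1)
    g j = sgn (j ∸ 1) * A j * state m a σ T (j ∸ 1)
    S x : Carrier
    S = sum1 m g
    x = sgn m * state m a σ T m
    first : f 1 ≈ S + x
    first = trans (*-congʳ (*-identityˡ _)) (*-identityˡ _)
    middle : sum1 m (λ j → f (suc j)) ≈ - S
    middle = trans (sum1-cong m (λ { (suc j) 1≤j j≤m → begin
        - sgn j * padded m A (suc j) * state m a σ T j ≈⟨ *-congʳ (*-congˡ (reflexive (padded-inner m A 1≤j j≤m))) ⟩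
        - sgn j * A (suc j) * state m a σ T j          ≈⟨ -‿distribˡ-*-* _ _ _ ⟩
        - g (suc j)                                    ∎ }))
      (sum1-neg m g)
    last : f (suc (suc m)) ≈ - x
    last = begin
      - sgn m * padded m A (suc m) * state m a σ T m  ≈⟨ *-congʳ (*-congˡ (reflexive (padded-last m A))) ⟩
      - sgn m * 1# * state m a σ T m                  ≈⟨ *-congʳ (*-identityʳ _) ⟩
      - sgn m * state m a σ T m                       ≈⟨ -‿distribˡ-* _ _ ⟨
      - x                                             ∎

  -- Continuing a row backwards gives a solution on all of ℤ, to which the periodicity
  -- hypothesis of E_{k+1,n} applies.
  module Extension (k : ℕ) (a : Coeffs) (σ : ℤ) where

    -- past t u = V_{σ-1-t-(k-u)}; a step solves the equation at p = σ-1-t for V_{p-k-1}.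
    past : ℕ → ℕ → Carrier
    past zero    u       = if ⌊ u ℕ.≟ k ⌋ then 1# else 0#
    past (suc t) zero    =
      sgn k * (past t k - sum1 k (λ j → sgn (j ∸ 1) * a (σ ℤ.- + suc t) j * past t (k ∸ j)))
    past (suc t) (suc u) = past t u

    past-shift : ∀ d X Y → past (d ℕ.+ X) (d ℕ.+ Y) ≡ past X Y
    past-shift zero    X Y = P.refl
    past-shift (suc d) X Y = past-shift d X Y

    past-start : past 0 k ≡ 1#
    past-start with k ℕ.≟ k
    ... | yes _  = P.refl
    ... | no k≢k = ⊥-elim (k≢k P.refl)

    past-start-zero : ∀ {u} → u ℕ.< k → past 0 u ≡ 0#
    past-start-zero {u} u<k with u ℕ.≟ k
    ... | yes P.refl = ⊥-elim (ℕP.<-irrefl P.refl u<k)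
    ... | no _       = P.refl

    past-zero : ∀ {q} → 1 ℕ.≤ q → q ℕ.≤ k → past q k ≡ 0#
    past-zero {q} 1≤q q≤k =
      P.trans (P.sym (P.cong₂ past (ℕP.+-identityʳ q) (ℕP.m+[n∸m]≡n q≤k)))
        (P.trans (past-shift q 0 (k ∸ q)) (past-start-zero (ℕP.∸-monoʳ-< 1≤q q≤k)))

    past-top : past (suc k) k ≈ sgn k
    past-top = begin
      past (suc k) k
        ≡⟨ P.cong₂ past (ℕP.+-comm k 1) (ℕP.+-identityʳ k) ⟨
      past (k ℕ.+ 1) (k ℕ.+ 0)
        ≡⟨ past-shift k 1 0 ⟩
      sgn k * (past 0 k - sum1 k (λ j → sgn (j ∸ 1) * a (σ ℤ.- + 1) j * past 0 (k ∸ j)))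
        ≈⟨ *-congˡ (+-cong (reflexive past-start) (-‿cong (sum1-zero k vanish))) ⟩
      sgn k * (1# - 0#)
        ≈⟨ *-congˡ (trans (+-congˡ ε⁻¹≈ε) (+-identityʳ 1#)) ⟩
      sgn k * 1#
        ≈⟨ *-identityʳ _ ⟩
      sgn k ∎
      where
      vanish : ∀ j → 1 ℕ.≤ j → j ℕ.≤ k → sgn (j ∸ 1) * a (σ ℤ.- + 1) j * past 0 (k ∸ j) ≈ 0#
      vanish j 1≤j j≤k = trans (*-congˡ (reflexive (past-start-zero (ℕP.∸-monoʳ-< 1≤j j≤k)))) (zeroʳ _)

    extended : ℤ → Carrier
    extended p with p ℤ.- (σ ℤ.- + 1)
    ... | + t      = row k a σ t
    ... | -[1+ q ] = past (suc q) k

    extended-fwd : ∀ p t → p ℤ.- (σ ℤ.- + 1) ≡ + t → extended p ≡ row k a σ t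
    extended-fwd p t eq with p ℤ.- (σ ℤ.- + 1)
    extended-fwd p t P.refl | .(+ t) = P.refl

    extended-back : ∀ p q → p ℤ.- (σ ℤ.- + 1) ≡ -[1+ q ] → extended p ≡ past (suc q) k
    extended-back p q eq with p ℤ.- (σ ℤ.- + 1)
    extended-back p q P.refl | .(-[1+ q ]) = P.refl

    extended≈state : ∀ p X Y → p ℤ.- (σ ℤ.- + 1) ≡ + X ℤ.- + Y → Y ℕ.≤ X ℕ.+ k →
                     extended p ≈ state k a σ X Y
    extended≈state p X Y eq Y≤X+k with p ℤ.- (σ ℤ.- + 1)
    ... | + t      = reflexive (state-diff k a σ t 0 X Y
                       (P.trans (ℕP.+-comm t Y) (P.trans (nonneg-diff eq) (P.sym (ℕP.+-identityʳ X)))))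
    ... | -[1+ q ] = reflexive (P.trans (past-zero (s≤s z≤n) q<k)
                       (P.sym (state-below k a σ (P.subst (X ℕ.<_) X+q+1≡Y (ℕP.m<m+n X (s≤s z≤n))))))
      where
      X+q+1≡Y : X ℕ.+ suc q ≡ Y
      X+q+1≡Y = neg-diff eq
      q<k : suc q ℕ.≤ k
      q<k = ℕP.+-cancelˡ-≤ X (suc q) k (P.subst (ℕ._≤ X ℕ.+ k) (P.sym X+q+1≡Y) Y≤X+k)

    extended-isSolution : IsSolution k a extended
    extended-isSolution i = solves (i ℤ.- (σ ℤ.- + 1)) P.refl
      where
      step-back : ∀ {z} j → i ℤ.- (σ ℤ.- + 1) ≡ z → (i ℤ.- + j) ℤ.- (σ ℤ.- + 1) ≡ z ℤ.- + j
      step-back {z} j eq = P.trans (lemma i (+ j) (σ ℤ.- + 1)) (P.cong (ℤ._- + j) eq)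
        where
        lemma : ∀ x y s → (x ℤ.- y) ℤ.- s ≡ (x ℤ.- s) ℤ.- y
        lemma = solve-∀

      index : ∀ {z} → i ℤ.- (σ ℤ.- + 1) ≡ z → i ≡ (σ ℤ.- + 1) ℤ.+ z
      index {z} eq = P.trans (lemma i (σ ℤ.- + 1)) (P.cong (λ x → (σ ℤ.- + 1) ℤ.+ x) eq)
        where
        lemma : ∀ x s → x ≡ s ℤ.+ (x ℤ.- s)
        lemma = solve-∀

      solves : ∀ z → i ℤ.- (σ ℤ.- + 1) ≡ z → extended i ≈ rhs k a extended i
      solves (+ suc t) eq = begin
        extended i
          ≡⟨ extended-fwd i (suc t) eq ⟩
        row k a σ (suc t)
          ≈⟨ +-cong (sum1-cong k term) (*-congˡ (sym (extended≈state (i ℤ.- + suc k) (suc t) (suc k)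
                                                       (step-back (suc k) eq) (s≤s (ℕP.m≤n+m k t))))) ⟩
        rhs k a extended i ∎
        where
        i≡σ+t : i ≡ σ ℤ.+ + t
        i≡σ+t = P.trans (index eq) (lemma σ (+ t))
          where
          lemma : ∀ s t → (s ℤ.- + 1) ℤ.+ (+ 1 ℤ.+ t) ≡ s ℤ.+ t
          lemma = solve-∀
        term : ∀ j → 1 ℕ.≤ j → j ℕ.≤ k →
               sgn (j ∸ 1) * a (σ ℤ.+ + t) j * state k a σ t (j ∸ 1) ≈ sgn (j ∸ 1) * a i j * extended (i ℤ.- + j)
        term j@(suc j′) _ j≤k =
          *-cong (*-congˡ (reflexive (P.cong (λ x → a x j) (P.sym i≡σ+t))))
                 (sym (extended≈state (i ℤ.- + j) (suc t) j (step-back j eq) (ℕP.≤-trans j≤k (ℕP.m≤n+m k (suc t)))))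
      solves (+ zero) eq = begin
        extended i
          ≡⟨ extended-fwd i 0 eq ⟩
        1#
          ≈⟨ sgn-square k ⟨
        sgn k * sgn k
          ≈⟨ +-identityˡ _ ⟨
        0# + sgn k * sgn k
          ≈⟨ +-cong (sym (sum1-zero k vanish))
                    (*-congˡ (sym (trans (reflexive (extended-back (i ℤ.- + suc k) k (step-back (suc k) eq))) past-top))) ⟩
        rhs k a extended i ∎
        where
        vanish : ∀ j → 1 ℕ.≤ j → j ℕ.≤ k → sgn (j ∸ 1) * a i j * extended (i ℤ.- + j) ≈ 0#
        vanish j@(suc _) _ j≤k = trans (*-congˡ (extended≈state (i ℤ.- + j) 0 j (step-back j eq) j≤k)) (zeroʳ _)
      solves -[1+ q ] eq = sym $ begin
        rhs k a extended i
          ≈⟨ +-cong (sum1-cong k term) (*-congˡ (reflexive last)) ⟩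
        S + sgn k * (sgn k * (G - S′))
          ≈⟨ +-congˡ (*-congˡ (*-congˡ (+-congˡ (-‿cong (sum1-cong k coefficient))))) ⟩
        S + sgn k * (sgn k * (G - S))
          ≈⟨ +-congˡ (trans (sym (*-assoc _ _ _)) (trans (*-congʳ (sgn-square k)) (*-identityˡ _))) ⟩
        S + (G - S)
          ≈⟨ +-assoc S G (- S) ⟨
        S + G - S
          ≈⟨ xyx⁻¹≈y S G ⟩
        G
          ≡⟨ extended-back i q eq ⟨
        extended i ∎
        where
        G S S′ : Carrier
        G = past (suc q) k
        S = sum1 k (λ j → sgn (j ∸ 1) * a i j * past (suc q) (k ∸ j))
        S′ = sum1 k (λ j → sgn (j ∸ 1) * a (σ ℤ.- + suc (suc q)) j * past (suc q) (k ∸ j))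
        term : ∀ j → 1 ℕ.≤ j → j ℕ.≤ k →
               sgn (j ∸ 1) * a i j * extended (i ℤ.- + j) ≈ sgn (j ∸ 1) * a i j * past (suc q) (k ∸ j)
        term j@(suc j′) _ j≤k = *-congˡ (reflexive (P.trans (extended-back (i ℤ.- + j) (suc (q ℕ.+ j′)) (step-back j eq))
          (P.trans (P.cong₂ past (P.cong suc (P.trans (P.cong suc (ℕP.+-comm q j′)) (P.sym (ℕP.+-suc j′ q))))
                                 (P.sym (ℕP.m+[n∸m]≡n j≤k)))
                   (past-shift j (suc q) (k ∸ j)))))
        last : extended (i ℤ.- + suc k) ≡ past (suc (suc q)) 0
        last = P.trans (extended-back (i ℤ.- + suc k) (suc (q ℕ.+ k)) (step-back (suc k) eq))
                 (P.trans (P.cong₂ past (ℕP.+-comm (suc (suc q)) k) (P.sym (ℕP.+-identityʳ k)))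
                          (past-shift k (suc (suc q)) 0))
        coefficient : ∀ j → 1 ℕ.≤ j → j ℕ.≤ k →
                      sgn (j ∸ 1) * a (σ ℤ.- + suc (suc q)) j * past (suc q) (k ∸ j)
                        ≈ sgn (j ∸ 1) * a i j * past (suc q) (k ∸ j)
        coefficient j _ _ = *-congʳ (*-congˡ (reflexive (P.cong (λ x → a x j)
                              (P.sym (P.trans (index eq) (lemma σ (+ suc q)))))))
          where
          lemma : ∀ s y → (s ℤ.- + 1) ℤ.+ (ℤ.- y) ≡ s ℤ.- (+ 1 ℤ.+ y)
          lemma = solve-∀

  module _ (k n : ℕ) (a : Coeffs) (inE : InE k n a) (σ : ℤ) where
    open Extension k a σ

    behind : ℕ → ℤ
    behind e = (σ ℤ.- + 1) ℤ.- + e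

    behind-index : ∀ e → behind e ℤ.- (σ ℤ.- + 1) ≡ + 0 ℤ.- + e
    behind-index e = lemma (σ ℤ.- + 1) (+ e)
      where
      lemma : ∀ s e → (s ℤ.- e) ℤ.- s ≡ + 0 ℤ.- e
      lemma = solve-∀

    row-wraps : ∀ o e → o ℕ.+ e ≡ n → row k a σ o ≈ sgn k * extended (behind e)
    row-wraps o e o+e≡n = begin
      row k a σ o                 ≡⟨ extended-fwd (p ℤ.+ + n) o index ⟨
      extended (p ℤ.+ + n)        ≈⟨ proj₂ inE extended extended-isSolution p ⟩
      sgn k * extended p          ∎
      where
      p : ℤ
      p = behind e
      lemma : ∀ s e o → ((s ℤ.- e) ℤ.+ (o ℤ.+ e)) ℤ.- s ≡ o
      lemma = solve-∀
      index : (p ℤ.+ + n) ℤ.- (σ ℤ.- + 1) ≡ + o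
      index = P.trans (P.cong (λ x → (p ℤ.+ x) ℤ.- (σ ℤ.- + 1))
                              (P.trans (P.cong +_ (P.sym o+e≡n)) (ℤP.pos-+ o e)))
                      (lemma (σ ℤ.- + 1) (+ e) (+ o))

    row-last-one : ∀ o → o ℕ.+ suc k ≡ n → row k a σ o ≈ 1#
    row-last-one o o+k+1≡n = begin
      row k a σ o                     ≈⟨ row-wraps o (suc k) o+k+1≡n ⟩
      sgn k * extended (behind (suc k)) ≡⟨ P.cong (sgn k *_) (extended-back (behind (suc k)) k (behind-index (suc k))) ⟩
      sgn k * past (suc k) k          ≈⟨ *-congˡ past-top ⟩
      sgn k * sgn k                   ≈⟨ sgn-square k ⟩
      1#                              ∎

    row-tail-zero : ∀ o e → o ℕ.+ e ≡ n → 1 ℕ.≤ e → e ℕ.≤ k → row k a σ o ≈ 0#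
    row-tail-zero o e@(suc _) o+e≡n _ e≤k = begin
      row k a σ o                 ≈⟨ row-wraps o e o+e≡n ⟩
      sgn k * extended (behind e) ≈⟨ *-congˡ (extended≈state (behind e) 0 e (behind-index e) e≤k) ⟩
      sgn k * 0#                  ≈⟨ zeroʳ _ ⟩
      0#                          ∎

  periodic-multiple : ∀ (f : ℤ → Carrier) N → (∀ x → f (x ℤ.+ N) ≈ f x) →
                      ∀ q x → f (x ℤ.+ q ℤ.* N) ≈ f x
  periodic-multiple f N per (+ m)    x = forward m x
    where
    forward : ∀ m x → f (x ℤ.+ + m ℤ.* N) ≈ f x
    forward zero    x = reflexive (P.cong f (lemma x N))
      where
      lemma : ∀ x N → x ℤ.+ + 0 ℤ.* N ≡ x
      lemma = solve-∀
    forward (suc m) x = begin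
      f (x ℤ.+ + suc m ℤ.* N)           ≡⟨ P.cong f (lemma x (+ m) N) ⟩
      f ((x ℤ.+ + m ℤ.* N) ℤ.+ N)       ≈⟨ per _ ⟩
      f (x ℤ.+ + m ℤ.* N)               ≈⟨ forward m x ⟩
      f x                               ∎
      where
      lemma : ∀ x m N → x ℤ.+ (+ 1 ℤ.+ m) ℤ.* N ≡ (x ℤ.+ m ℤ.* N) ℤ.+ N
      lemma = solve-∀
  periodic-multiple f N per -[1+ m ] x = begin
    f (x ℤ.+ -[1+ m ] ℤ.* N)                           ≈⟨ periodic-multiple f N per (+ suc m) _ ⟨
    f ((x ℤ.+ -[1+ m ] ℤ.* N) ℤ.+ + suc m ℤ.* N)       ≡⟨ P.cong f (lemma x (+ suc m) N) ⟩
    f x                                                ∎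
    where
    lemma : ∀ x y N → (x ℤ.+ (ℤ.- y) ℤ.* N) ℤ.+ y ℤ.* N ≡ x
    lemma = solve-∀

  -- The Gale dual frieze

  galeCoeffs≡state : ∀ k a w x l → galeCoeffs k a w x l ≡ state k a (x ℤ.+ + 1) (suc w) l
  galeCoeffs≡state k a w x l =
    frieze≡state k a (x ℤ.+ + 1) (+ w ℤ.+ x ℤ.- + l ℤ.+ + 1) (suc w) l (lemma (+ w) x (+ l))
    where
    lemma : ∀ w x l → (((w ℤ.+ x) ℤ.- l) ℤ.+ + 1) ℤ.- ((x ℤ.+ + 1) ℤ.- + 1) ≡ (+ 1 ℤ.+ w) ℤ.- l
    lemma = solve-∀

  reversedCoeffs : ℕ → (ℕ → Carrier) → ℕ → Carrier
  reversedCoeffs k A v = if ⌊ v ℕ.≤? suc k ⌋ then padded k A (suc k ∸ v) else 0#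

  reversedCoeffs-within : ∀ k A {v} → v ℕ.≤ suc k → reversedCoeffs k A v ≡ padded k A (suc k ∸ v)
  reversedCoeffs-within k A {v} v≤k+1 with v ℕ.≤? suc k
  ... | yes _    = P.refl
  ... | no v≰k+1 = ⊥-elim (v≰k+1 v≤k+1)

  reversedCoeffs-beyond : ∀ k A {v} → suc k ℕ.< v → reversedCoeffs k A v ≡ 0#
  reversedCoeffs-beyond k A {v} k+1<v with v ℕ.≤? suc k
  ... | yes v≤k+1 = ⊥-elim (ℕP.<-irrefl P.refl (ℕP.<-≤-trans k+1<v v≤k+1))
  ... | no _      = P.refl

  reversedCoeffs-first : ∀ k A → reversedCoeffs k A 0 ≡ 1#
  reversedCoeffs-first k A = P.trans (reversedCoeffs-within k A z≤n) (padded-last k A)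

  reversedCoeffs-reverse : ∀ k A {j} → j ℕ.≤ suc k → reversedCoeffs k A (suc k ∸ j) ≡ padded k A j
  reversedCoeffs-reverse k A {j} j≤k+1 =
    P.trans (reversedCoeffs-within k A (ℕP.m∸n≤m (suc k) j)) (P.cong (padded k A) (ℕP.m∸[m∸n]≡n j≤k+1))

  band≈ : ∀ lo hi col x y → (lo ℕ.≤ col → col ℕ.≤ hi → x ≈ y) → (col ℕ.< lo → y ≈ 0#) →
          (hi ℕ.< col → y ≈ 0#) → band lo hi col x ≈ y
  band≈ lo hi col x y inside below above with lo ℕ.≤? col | col ℕ.≤? hi
  ... | yes lo≤col | yes col≤hi = inside lo≤col col≤hi
  ... | yes _      | no col≰hi  = sym (above (ℕP.≰⇒> col≰hi))
  ... | no lo≰col  | _          = sym (below (ℕP.≰⇒> lo≰col))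

  matrix-index : ∀ x c r → ((x ℤ.+ + suc c) ℤ.- + 2) ℤ.- ((x ℤ.+ + r) ℤ.- + 1) ≡ + c ℤ.- + r
  matrix-index x c r = lemma x (+ c) (+ r)
    where
    lemma : ∀ x c r → ((x ℤ.+ (+ 1 ℤ.+ c)) ℤ.- + 2) ℤ.- ((x ℤ.+ r) ℤ.- + 1) ≡ c ℤ.- r
    lemma = solve-∀

  module Duality (k w : ℕ) (a : Coeffs) (inE : InE k (k ℕ.+ suc (suc w)) a) where
    n : ℕ
    n = k ℕ.+ suc (suc w)

    α : Coeffs
    α = galeCoeffs k a w

    a-periodic : ∀ x l → 1 ℕ.≤ l → l ℕ.≤ k → a (x ℤ.+ + n) l ≈ a x l
    a-periodic = proj₁ inE

    a-periodic-multiple : ∀ q x l → 1 ℕ.≤ l → l ℕ.≤ k → a (x ℤ.+ q ℤ.* + n) l ≈ a x l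
    a-periodic-multiple q x l 1≤l l≤k =
      periodic-multiple (λ y → a y l) (+ n) (λ y → a-periodic y l 1≤l l≤k) q x

    row-zero-after-last : ∀ σ o → suc w ℕ.< o → o ℕ.< n → row k a σ o ≈ 0#
    row-zero-after-last σ o w+1<o o<n =
      row-tail-zero k n a inE σ o (n ∸ o) (ℕP.m+[n∸m]≡n (ℕP.<⇒≤ o<n)) (ℕP.m<n⇒0<n∸m o<n) n-o≤k
      where
      n-o≤k : n ∸ o ℕ.≤ k
      n-o≤k = ℕP.≤-trans (ℕP.∸-monoʳ-≤ n w+1<o) (ℕP.≤-reflexive (ℕP.m+n∸n≡m k (suc (suc w))))

    module DualRow (τ : ℤ) where
      coeffs : ℕ → Carrier
      coeffs = reversedCoeffs k (a (τ ℤ.- + 1))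

      module Step (X R : ℕ) (X+2+R≡n : suc (suc X) ℕ.+ R ≡ n)
                  (hyp : ∀ Y → Y ℕ.≤ w → state w α τ X Y ≈ delay coeffs X Y) where
        σ : ℤ
        σ = (τ ℤ.+ + X) ℤ.+ + 1

        Φ : ℕ → ℕ → Carrier
        Φ = state k a σ

        Lsum Llast : Carrier
        Lsum = sum1 w (λ l → sgn (l ∸ 1) * Φ (suc w) l * delay coeffs X (l ∸ 1))
        Llast = sgn w * delay coeffs X w

        unfolded : state w α τ (suc X) 0 ≈ Lsum + Llast
        unfolded =
          +-cong (sum1-cong w (λ l _ l≤w → *-cong (*-congˡ (reflexive (galeCoeffs≡state k a w (τ ℤ.+ + X) l)))
                                                  (hyp (l ∸ 1) (ℕP.≤-trans (ℕP.m∸n≤m l 1) l≤w))))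
                 (*-congˡ (hyp w ℕP.≤-refl))

        residual-term : ℕ → Carrier
        residual-term j = sgn (j ∸ 1) * Φ (suc w) (j ∸ 1) * delay coeffs (suc X) (j ∸ 1)

        residual : Carrier
        residual = sum1 (suc (suc w)) residual-term

        residual≈ : residual ≈ coeffs (suc X) - (Lsum + Llast)
        residual≈ = begin
          sum1 (suc w) residual-term + residual-term (suc (suc w))
            ≈⟨ +-cong (sum1-unfoldˡ w residual-term) last ⟩
          residual-term 1 + sum1 w (λ j → residual-term (suc j)) + - Llast
            ≈⟨ +-congʳ (+-cong first middle) ⟩
          coeffs (suc X) + - Lsum + - Llast
            ≈⟨ +-assoc _ _ _ ⟩
          coeffs (suc X) + (- Lsum + - Llast)
            ≈⟨ +-congˡ (⁻¹-∙-comm Lsum Llast) ⟩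
          coeffs (suc X) - (Lsum + Llast) ∎
          where
          first : residual-term 1 ≈ coeffs (suc X)
          first = begin
            1# * Φ (suc w) 0 * coeffs (suc X)  ≈⟨ *-congʳ (*-identityˡ _) ⟩
            Φ (suc w) 0 * coeffs (suc X)       ≈⟨ *-congʳ (row-last-one k n a inE σ (suc w) w+1+k+1≡n) ⟩
            1# * coeffs (suc X)                ≈⟨ *-identityˡ _ ⟩
            coeffs (suc X)                     ∎
            where
            w+1+k+1≡n : suc w ℕ.+ suc k ≡ n
            w+1+k+1≡n = P.trans (ℕP.+-comm (suc w) (suc k)) (P.sym (ℕP.+-suc k (suc w)))
          middle : sum1 w (λ j → residual-term (suc j)) ≈ - Lsum
          middle = trans (sum1-cong w (λ { (suc j) _ _ → -‿distribˡ-*-* _ _ _ }))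
                         (sum1-neg w (λ l → sgn (l ∸ 1) * Φ (suc w) l * delay coeffs X (l ∸ 1)))
          last : residual-term (suc (suc w)) ≈ - Llast
          last = begin
            - sgn w * Φ (suc w) (suc w) * delay coeffs X w
              ≈⟨ *-congʳ (*-congˡ (reflexive (state-diff k a σ (suc w) (suc w) 0 0 (ℕP.+-comm (suc w) 0)))) ⟩
            - sgn w * 1# * delay coeffs X w
              ≈⟨ *-congʳ (*-identityʳ _) ⟩
            - sgn w * delay coeffs X w
              ≈⟨ -‿distribˡ-* _ _ ⟨
            - Llast ∎

        -- Σ summand collapses to ± residual because row σ vanishes after its last 1, and to
        -- ± the equation at σ+R ≡ τ-1 (mod n) because coeffs is supported on [0, k+1].
        summand : ℕ → Carrier
        summand z = sgn z * Φ n z * delay coeffs (suc X ℕ.+ suc k) z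

        sum-by-row : sum1 (n ℕ.+ k) summand ≈ sgn (suc k) * residual
        sum-by-row = begin
          sum1 (k ℕ.+ suc (suc w) ℕ.+ k) summand
            ≈⟨ sum1-restrict k (suc (suc w)) k summand before after ⟩
          sum1 (suc (suc w)) (λ j → summand (k ℕ.+ j))
            ≈⟨ sum1-cong (suc (suc w)) middle ⟩
          sum1 (suc (suc w)) (λ j → sgn (suc k) * residual-term j)
            ≈⟨ sum1-*ˡ (suc (suc w)) (sgn (suc k)) residual-term ⟩
          sgn (suc k) * residual ∎
          where
          before : ∀ j → 1 ℕ.≤ j → j ℕ.≤ k → summand j ≈ 0#
          before j 1≤j j≤k = *-zero-middle (trans (reflexive (state-diff k a σ n j (n ∸ j) 0 n-j+j≡n))
                                                  (row-tail-zero k n a inE σ (n ∸ j) j (ℕP.m∸n+n≡m j≤n) 1≤j j≤k))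
            where
            j≤n : j ℕ.≤ n
            j≤n = ℕP.≤-trans j≤k (ℕP.m≤m+n k _)
            n-j+j≡n : n ℕ.+ 0 ≡ n ∸ j ℕ.+ j
            n-j+j≡n = P.trans (ℕP.+-identityʳ n) (P.sym (ℕP.m∸n+n≡m j≤n))
          after : ∀ j → 1 ℕ.≤ j → j ℕ.≤ k → summand (n ℕ.+ j) ≈ 0#
          after j 1≤j _ = *-zero-middle (reflexive (state-below k a σ (ℕP.m<m+n n 1≤j)))
          middle : ∀ j → 1 ℕ.≤ j → j ℕ.≤ suc (suc w) → summand (k ℕ.+ j) ≈ sgn (suc k) * residual-term j
          middle j@(suc j′) _ _ = begin
            sgn (k ℕ.+ j) * Φ n (k ℕ.+ j) * delay coeffs (suc X ℕ.+ suc k) (k ℕ.+ j)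
              ≈⟨ *-cong (*-cong (trans (reflexive (P.cong sgn (ℕP.+-suc k j′))) (sgn-+ (suc k) j′))
                                (reflexive (state-diff k a σ n (k ℕ.+ j) (suc w) j′ (lemma₁ k w j′))))
                        (reflexive (delay-diff coeffs (suc X ℕ.+ suc k) (k ℕ.+ j) (suc X) j′ (lemma₂ X k j′))) ⟩
            sgn (suc k) * sgn j′ * Φ (suc w) j′ * delay coeffs (suc X) j′
              ≈⟨ xy∙z∙w≈x∙[yz∙w] _ _ _ _ ⟩
            sgn (suc k) * residual-term j ∎
            where
            lemma₁ : ∀ k w j → k ℕ.+ suc (suc w) ℕ.+ j ≡ suc w ℕ.+ (k ℕ.+ suc j)
            lemma₁ = ℕSolver.solve-∀
            lemma₂ : ∀ X k j → suc X ℕ.+ suc k ℕ.+ j ≡ suc X ℕ.+ (k ℕ.+ suc j)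
            lemma₂ = ℕSolver.solve-∀

        recurrence-term : ℕ → Carrier
        recurrence-term j = sgn (j ∸ 1) * padded k (a (σ ℤ.+ + R)) (j ∸ 1) * Φ (suc R) (j ∸ 1)

        sum-by-coefficients : sum1 (n ℕ.+ k) summand ≈ sgn (suc X) * sum1 (suc (suc k)) recurrence-term
        sum-by-coefficients = begin
          sum1 (n ℕ.+ k) summand
            ≡⟨ P.cong (λ m → sum1 m summand) length ⟩
          sum1 (X ℕ.+ suc (suc k) ℕ.+ R) summand
            ≈⟨ sum1-restrict X (suc (suc k)) R summand before after ⟩
          sum1 (suc (suc k)) (λ j → summand (X ℕ.+ j))
            ≈⟨ sum1-cong (suc (suc k)) middle ⟩
          sum1 (suc (suc k)) (λ j → sgn (suc X) * recurrence-term j)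
            ≈⟨ sum1-*ˡ (suc (suc k)) (sgn (suc X)) recurrence-term ⟩
          sgn (suc X) * sum1 (suc (suc k)) recurrence-term ∎
          where
          length : n ℕ.+ k ≡ X ℕ.+ suc (suc k) ℕ.+ R
          length = P.trans (P.cong (ℕ._+ k) (P.sym X+2+R≡n)) (lemma X R k)
            where
            lemma : ∀ X R k → suc (suc X) ℕ.+ R ℕ.+ k ≡ X ℕ.+ suc (suc k) ℕ.+ R
            lemma = ℕSolver.solve-∀
          before : ∀ j → 1 ℕ.≤ j → j ℕ.≤ X → summand j ≈ 0#
          before j _ j≤X = *-zero-last (reflexive (P.trans (delay-at coeffs j (suc (X ∸ j) ℕ.+ suc k) index)
                                                           (reversedCoeffs-beyond k _ (s≤s (ℕP.m≤n+m (suc k) (X ∸ j))))))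
            where
            index : j ℕ.+ (suc (X ∸ j) ℕ.+ suc k) ≡ suc X ℕ.+ suc k
            index = P.trans (lemma j (X ∸ j) k) (P.cong (λ x → suc x ℕ.+ suc k) (ℕP.m+[n∸m]≡n j≤X))
              where
              lemma : ∀ j d k → j ℕ.+ (suc d ℕ.+ suc k) ≡ suc (j ℕ.+ d) ℕ.+ suc k
              lemma = ℕSolver.solve-∀
          after : ∀ j → 1 ℕ.≤ j → j ℕ.≤ R → summand (X ℕ.+ suc (suc k) ℕ.+ j) ≈ 0#
          after j 1≤j _ = *-zero-last (reflexive (delay-below coeffs
                            (P.subst (suc X ℕ.+ suc k ℕ.<_) (lemma X k j) (ℕP.m<m+n (suc X ℕ.+ suc k) 1≤j))))
            where
            lemma : ∀ X k j → suc X ℕ.+ suc k ℕ.+ j ≡ X ℕ.+ suc (suc k) ℕ.+ j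
            lemma = ℕSolver.solve-∀
          A≈A′ : ∀ l → 1 ℕ.≤ l → l ℕ.≤ k → a (τ ℤ.- + 1) l ≈ a (σ ℤ.+ + R) l
          A≈A′ l 1≤l l≤k = sym (trans (reflexive (P.cong (λ x → a x l) index)) (a-periodic (τ ℤ.- + 1) l 1≤l l≤k))
            where
            lemma : ∀ t X R → ((t ℤ.+ X) ℤ.+ + 1) ℤ.+ R ≡ (t ℤ.- + 1) ℤ.+ ((+ 1 ℤ.+ (+ 1 ℤ.+ X)) ℤ.+ R)
            lemma = solve-∀
            index : σ ℤ.+ + R ≡ (τ ℤ.- + 1) ℤ.+ + n
            index = P.trans (lemma τ (+ X) (+ R))
                      (P.cong (λ x → (τ ℤ.- + 1) ℤ.+ x)
                              (P.trans (P.sym (ℤP.pos-+ (suc (suc X)) R)) (P.cong +_ X+2+R≡n)))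
          middle : ∀ j → 1 ℕ.≤ j → j ℕ.≤ suc (suc k) → summand (X ℕ.+ j) ≈ sgn (suc X) * recurrence-term j
          middle j@(suc j′) _ j≤k+2 = begin
            sgn (X ℕ.+ j) * Φ n (X ℕ.+ j) * delay coeffs (suc X ℕ.+ suc k) (X ℕ.+ j)
              ≈⟨ *-cong (*-cong (trans (reflexive (P.cong sgn (ℕP.+-suc X j′))) (sgn-+ (suc X) j′))
                                (reflexive (state-diff k a σ n (X ℕ.+ j) (suc R) j′ rowIndex)))
                        coefficient ⟩
            sgn (suc X) * sgn j′ * Φ (suc R) j′ * padded k (a (σ ℤ.+ + R)) j′
              ≈⟨ xy∙z∙w≈x∙[yw∙z] _ _ _ _ ⟩
            sgn (suc X) * recurrence-term j ∎
            where
            j′≤k+1 : j′ ℕ.≤ suc k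
            j′≤k+1 = ℕP.≤-pred j≤k+2
            rowIndex : n ℕ.+ j′ ≡ suc R ℕ.+ (X ℕ.+ j)
            rowIndex = P.trans (P.cong (ℕ._+ j′) (P.sym X+2+R≡n)) (lemma X R j′)
              where
              lemma : ∀ X R j → suc (suc X) ℕ.+ R ℕ.+ j ≡ suc R ℕ.+ (X ℕ.+ suc j)
              lemma = ℕSolver.solve-∀
            coeffIndex : X ℕ.+ j ℕ.+ (suc k ∸ j′) ≡ suc X ℕ.+ suc k
            coeffIndex = P.trans (lemma X j′ (suc k ∸ j′))
                           (P.cong (λ x → suc X ℕ.+ x) (ℕP.m+[n∸m]≡n j′≤k+1))
              where
              lemma : ∀ X j d → X ℕ.+ suc j ℕ.+ d ≡ suc X ℕ.+ (j ℕ.+ d)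
              lemma = ℕSolver.solve-∀
            coefficient : delay coeffs (suc X ℕ.+ suc k) (X ℕ.+ j) ≈ padded k (a (σ ℤ.+ + R)) j′
            coefficient = trans (reflexive (P.trans (delay-at coeffs (X ℕ.+ j) (suc k ∸ j′) coeffIndex)
                                                    (reversedCoeffs-reverse k _ j′≤k+1)))
                                (padded-cong k A≈A′ j′)

        residual≈0 : residual ≈ 0#
        residual≈0 = sgn-*-≈0 (suc k) (begin
          sgn (suc k) * residual                              ≈⟨ sum-by-row ⟨
          sum1 (n ℕ.+ k) summand                              ≈⟨ sum-by-coefficients ⟩
          sgn (suc X) * sum1 (suc (suc k)) recurrence-term    ≈⟨ *-congˡ (state-recurrence k a σ R) ⟩
          sgn (suc X) * 0#                                    ≈⟨ zeroʳ _ ⟩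
          0#                                                  ∎)

        next : state w α τ (suc X) 0 ≈ coeffs (suc X)
        next = trans unfolded (sym (x∙y⁻¹≈ε⇒x≈y _ _ (trans (sym residual≈) residual≈0)))

      dual-row : ∀ X Y → X ℕ.< n → Y ℕ.≤ w → state w α τ X Y ≈ delay coeffs X Y
      dual-row zero    zero    _     _     = sym (reflexive (reversedCoeffs-first k (a (τ ℤ.- + 1))))
      dual-row zero    (suc Y) _     _     = refl
      dual-row (suc X) (suc Y) X+1<n Y+1≤w =
        dual-row X Y (ℕP.<-trans (ℕP.n<1+n X) X+1<n) (ℕP.≤-trans (ℕP.n≤1+n Y) Y+1≤w)
      dual-row (suc X) zero    X+1<n _ with ℕP.m≤n⇒∃[o]m+o≡n X+1<n
      ... | R , X+2+R≡n = Step.next X R X+2+R≡n (λ Y → dual-row X Y X<n)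
        where
        X<n : X ℕ.< n
        X<n = ℕP.<-trans (ℕP.n<1+n X) X+1<n

    M-entry : ∀ i r c → 1 ℕ.≤ c → c ℕ.≤ n →
              friezeMatrix (frieze k a) w i r c ≈ state k a (i ℤ.+ + r) (c ∸ 1) r
    M-entry i r c@(suc c′) _ c≤n = band≈ (suc r) (r ℕ.+ w ℕ.+ 2) c _ _
      (λ _ _ → reflexive (frieze≡state k a (i ℤ.+ + r) (i ℤ.+ + c ℤ.- + 2) c′ r (matrix-index i c′ r)))
      (λ c≤r → reflexive (state-below k a _ (ℕP.≤-pred c≤r)))
      above
      where
      above : r ℕ.+ w ℕ.+ 2 ℕ.< c → state k a (i ℤ.+ + r) c′ r ≈ 0#
      above r+w+2<c = trans (reflexive (state-diff k a _ c′ r (c′ ∸ r) 0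
                                                 (P.trans (ℕP.+-identityʳ c′) (P.sym (ℕP.m∸n+n≡m r≤c′)))))
                            (row-zero-after-last _ (c′ ∸ r) w+1<c′-r (ℕP.≤-<-trans (ℕP.m∸n≤m c′ r) c≤n))
        where
        r+w+2≤c′ : r ℕ.+ suc (suc w) ℕ.≤ c′
        r+w+2≤c′ = P.subst (ℕ._≤ c′) (P.trans (ℕP.+-assoc r w 2) (P.cong (r ℕ.+_) (ℕP.+-comm w 2)))
                           (ℕP.≤-pred r+w+2<c)
        r≤c′ : r ℕ.≤ c′
        r≤c′ = ℕP.≤-trans (ℕP.m≤m+n r _) r+w+2≤c′
        w+1<c′-r : suc w ℕ.< c′ ∸ r
        w+1<c′-r = ℕP.m+n≤o⇒m≤o∸n (suc (suc w)) (P.subst (ℕ._≤ c′) (ℕP.+-comm r _) r+w+2≤c′)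

    N-entry : ∀ j r′ c → r′ ℕ.≤ w → 1 ℕ.≤ c → c ℕ.≤ n →
              friezeMatrix (frieze w α) k j r′ c ≈ delay (DualRow.coeffs (j ℤ.+ + r′)) (c ∸ 1) r′
    N-entry j r′ c@(suc c′) r′≤w _ c≤n = band≈ (suc r′) (r′ ℕ.+ k ℕ.+ 2) c _ _
      (λ _ _ → trans (reflexive (frieze≡state w α (j ℤ.+ + r′) (j ℤ.+ + c ℤ.- + 2) c′ r′ (matrix-index j c′ r′)))
                     (DualRow.dual-row (j ℤ.+ + r′) c′ r′ c≤n r′≤w))
      (λ c≤r′ → reflexive (delay-below coeffs (ℕP.≤-pred c≤r′)))
      above
      where
      open DualRow (j ℤ.+ + r′) using (coeffs)
      above : r′ ℕ.+ k ℕ.+ 2 ℕ.< c → delay coeffs c′ r′ ≈ 0#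
      above r′+k+2<c = reflexive (P.trans (delay-at coeffs r′ (c′ ∸ r′) (ℕP.m+[n∸m]≡n r′≤c′))
                                          (reversedCoeffs-beyond k _ k+1<c′-r′))
        where
        r′+k+2≤c′ : r′ ℕ.+ suc (suc k) ℕ.≤ c′
        r′+k+2≤c′ = P.subst (ℕ._≤ c′) (P.trans (ℕP.+-assoc r′ k 2) (P.cong (r′ ℕ.+_) (ℕP.+-comm k 2)))
                            (ℕP.≤-pred r′+k+2<c)
        r′≤c′ : r′ ℕ.≤ c′
        r′≤c′ = ℕP.≤-trans (ℕP.m≤m+n r′ _) r′+k+2≤c′
        k+1<c′-r′ : suc k ℕ.< c′ ∸ r′
        k+1<c′-r′ = ℕP.m+n≤o⇒m≤o∸n (suc (suc k)) (P.subst (ℕ._≤ c′) (ℕP.+-comm r′ _) r′+k+2≤c′)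

    module Pairing (i j q : ℤ) (i-j≡ : i ℤ.- j ≡ + (w ℕ.+ 1) ℤ.+ q ℤ.* + n)
                   (r r′ : ℕ) (r≤k : r ℕ.≤ k) (r′≤w : r′ ℕ.≤ w) where
      s τ : ℤ
      s = i ℤ.+ + r
      τ = j ℤ.+ + r′

      open DualRow τ using (coeffs)

      T : ℕ
      T = (k ∸ r) ℕ.+ r′

      pairing : ℕ → Carrier
      pairing X = state k a s X r * sgn X * delay coeffs X r′

      recurrence-term : ℕ → Carrier
      recurrence-term l = sgn (l ∸ 1) * padded k (a (s ℤ.+ + T)) (l ∸ 1) * state k a s (suc T) (l ∸ 1)

      A≈A′ : ∀ l → 1 ℕ.≤ l → l ℕ.≤ k → a (τ ℤ.- + 1) l ≈ a (s ℤ.+ + T) l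
      A≈A′ l 1≤l l≤k = sym (trans (reflexive (P.cong (λ x → a x l) index))
                                  (a-periodic-multiple (+ 1 ℤ.+ q) (τ ℤ.- + 1) l 1≤l l≤k))
        where
        e : ℕ
        e = k ∸ r
        n≡ : + n ≡ + (r ℕ.+ e ℕ.+ suc (suc w))
        n≡ = P.cong (λ x → + (x ℕ.+ suc (suc w))) (P.sym (ℕP.m+[n∸m]≡n r≤k))
        from-difference : ∀ x y z → x ℤ.- y ≡ z → x ≡ y ℤ.+ z
        from-difference x y z eq = P.trans (lemma x y) (P.cong (λ u → y ℤ.+ u) eq)
          where
          lemma : ∀ x y → x ≡ y ℤ.+ (x ℤ.- y)
          lemma = solve-∀
        lemma : ∀ j q w r e r′ →
          ((j ℤ.+ ((w ℤ.+ + 1) ℤ.+ q ℤ.* ((r ℤ.+ e) ℤ.+ (+ 1 ℤ.+ (+ 1 ℤ.+ w))))) ℤ.+ r) ℤ.+ (e ℤ.+ r′)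
            ≡ ((j ℤ.+ r′) ℤ.- + 1) ℤ.+ (+ 1 ℤ.+ q) ℤ.* ((r ℤ.+ e) ℤ.+ (+ 1 ℤ.+ (+ 1 ℤ.+ w)))
        lemma = solve-∀
        index : s ℤ.+ + T ≡ (τ ℤ.- + 1) ℤ.+ (+ 1 ℤ.+ q) ℤ.* + n
        index = P.trans (P.cong₂ (λ x y → (x ℤ.+ + r) ℤ.+ y) (from-difference i j _ i-j≡) (ℤP.pos-+ e r′))
                  (P.trans (P.cong (λ N → ((j ℤ.+ (+ (w ℕ.+ 1) ℤ.+ q ℤ.* N)) ℤ.+ + r) ℤ.+ (+ e ℤ.+ + r′)) n≡)
                  (P.trans (lemma j q (+ w) (+ r) (+ e) (+ r′))
                           (P.cong (λ N → (τ ℤ.- + 1) ℤ.+ (+ 1 ℤ.+ q) ℤ.* N) (P.sym n≡))))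

      pairing-reversed : ∀ l → 1 ℕ.≤ l → l ℕ.≤ suc (suc k) →
                         pairing (r′ ℕ.+ ((suc (suc (suc k)) ∸ l) ∸ 1)) ≈ sgn (r′ ℕ.+ suc k) * recurrence-term l
      pairing-reversed l@(suc l′) _ l≤k+2 = begin
        pairing (r′ ℕ.+ ((suc (suc k) ∸ l′) ∸ 1))
          ≡⟨ P.cong (λ x → pairing (r′ ℕ.+ (x ∸ 1))) (ℕP.+-∸-assoc 1 l′≤k+1) ⟩
        state k a s (r′ ℕ.+ v) r * sgn (r′ ℕ.+ v) * delay coeffs (r′ ℕ.+ v) r′
          ≈⟨ *-cong (*-cong (reflexive (state-diff k a s (r′ ℕ.+ v) r (suc T) l′ rowIndex))
                            (sym (sgn-complement l′ (r′ ℕ.+ v) (P.trans (ℕP.+-comm l′ (r′ ℕ.+ v)) r′+v+l′≡r′+k+1))))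
                    coefficient ⟩
        state k a s (suc T) l′ * (sgn (r′ ℕ.+ suc k) * sgn l′) * padded k (a (s ℤ.+ + T)) l′
          ≈⟨ x∙yz∙w≈y∙[zw∙x] _ _ _ _ ⟩
        sgn (r′ ℕ.+ suc k) * recurrence-term l ∎
        where
        l′≤k+1 : l′ ℕ.≤ suc k
        l′≤k+1 = ℕP.≤-pred l≤k+2
        v : ℕ
        v = suc k ∸ l′
        r′+v+l′≡r′+k+1 : r′ ℕ.+ v ℕ.+ l′ ≡ r′ ℕ.+ suc k
        r′+v+l′≡r′+k+1 = P.trans (ℕP.+-assoc r′ v l′) (P.cong (r′ ℕ.+_) (ℕP.m∸n+n≡m l′≤k+1))
        rowIndex : r′ ℕ.+ v ℕ.+ l′ ≡ suc T ℕ.+ r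
        rowIndex = P.trans r′+v+l′≡r′+k+1
                     (P.trans (P.cong (λ x → r′ ℕ.+ suc x) (P.sym (ℕP.m+[n∸m]≡n r≤k))) (lemma r′ (k ∸ r) r))
          where
          lemma : ∀ r′ e r → r′ ℕ.+ suc (r ℕ.+ e) ≡ suc (e ℕ.+ r′) ℕ.+ r
          lemma = ℕSolver.solve-∀
        coefficient : delay coeffs (r′ ℕ.+ v) r′ ≈ padded k (a (s ℤ.+ + T)) l′
        coefficient = trans (reflexive (P.trans (delay-at coeffs r′ v P.refl) (reversedCoeffs-reverse k _ l′≤k+1)))
                            (padded-cong k A≈A′ l′)

      vanishes : prodEntry n (friezeMatrix (frieze k a) w i) (friezeMatrix (frieze w α) k j) r r′ ≈ 0#
      vanishes = begin
        prodEntry n (friezeMatrix (frieze k a) w i) (friezeMatrix (frieze w α) k j) r r′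
          ≈⟨ sum1-cong n (λ c 1≤c c≤n → *-cong (*-congʳ (M-entry i r c 1≤c c≤n))
                                               (N-entry j r′ c r′≤w 1≤c c≤n)) ⟩
        sum1 n (λ c → pairing (c ∸ 1))
          ≡⟨ P.cong (λ m → sum1 m (λ c → pairing (c ∸ 1))) length ⟩
        sum1 (r′ ℕ.+ suc (suc k) ℕ.+ (w ∸ r′)) (λ c → pairing (c ∸ 1))
          ≈⟨ sum1-restrict r′ (suc (suc k)) (w ∸ r′) _ before after ⟩
        sum1 (suc (suc k)) (λ v → pairing ((r′ ℕ.+ v) ∸ 1))
          ≈⟨ sum1-cong (suc (suc k)) (λ { (suc v) _ _ →
               reflexive (P.cong (λ x → pairing (x ∸ 1)) (ℕP.+-suc r′ v)) }) ⟩
        sum1 (suc (suc k)) (λ v → pairing (r′ ℕ.+ (v ∸ 1)))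
          ≈⟨ sum1-reverse (suc (suc k)) _ ⟩
        sum1 (suc (suc k)) (λ l → pairing (r′ ℕ.+ ((suc (suc (suc k)) ∸ l) ∸ 1)))
          ≈⟨ sum1-cong (suc (suc k)) pairing-reversed ⟩
        sum1 (suc (suc k)) (λ l → sgn (r′ ℕ.+ suc k) * recurrence-term l)
          ≈⟨ sum1-*ˡ (suc (suc k)) _ recurrence-term ⟩
        sgn (r′ ℕ.+ suc k) * sum1 (suc (suc k)) recurrence-term
          ≈⟨ *-congˡ (state-recurrence k a s T) ⟩
        sgn (r′ ℕ.+ suc k) * 0#
          ≈⟨ zeroʳ _ ⟩
        0# ∎
        where
        length : n ≡ r′ ℕ.+ suc (suc k) ℕ.+ (w ∸ r′)
        length = P.trans (P.cong (λ x → k ℕ.+ suc (suc x)) (P.sym (ℕP.m+[n∸m]≡n r′≤w))) (lemma k r′ (w ∸ r′))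
          where
          lemma : ∀ k r′ d → k ℕ.+ suc (suc (r′ ℕ.+ d)) ≡ r′ ℕ.+ suc (suc k) ℕ.+ d
          lemma = ℕSolver.solve-∀
        before : ∀ c → 1 ℕ.≤ c → c ℕ.≤ r′ → pairing (c ∸ 1) ≈ 0#
        before (suc c′) _ c≤r′ = *-zero-last (reflexive (delay-below coeffs c≤r′))
        after : ∀ c → 1 ℕ.≤ c → c ℕ.≤ w ∸ r′ → pairing ((r′ ℕ.+ suc (suc k) ℕ.+ c) ∸ 1) ≈ 0#
        after c 1≤c _ = *-zero-last (reflexive (P.trans (delay-at coeffs r′ (suc k ℕ.+ c) index)
                                                       (reversedCoeffs-beyond k _ (ℕP.m<m+n (suc k) 1≤c))))
          where
          lemma : ∀ r′ k c → r′ ℕ.+ suc (suc k) ℕ.+ c ≡ suc (r′ ℕ.+ (suc k ℕ.+ c))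
          lemma = ℕSolver.solve-∀
          index : r′ ℕ.+ (suc k ℕ.+ c) ≡ r′ ℕ.+ suc (suc k) ℕ.+ c ∸ 1
          index = P.cong (_∸ 1) (P.sym (lemma r′ k c))

gale-orthogonal : ∀ {c ℓ : Level} (R : CommutativeRing c ℓ) →
    let open CommutativeRing R
        open Frieze R
    in (k n w : ℕ) → n ≡ k ℕ.+ suc (suc w) → (a : Coeffs) → InE k n a →
       (i j q : ℤ) → i ℤ.- j ≡ + (w ℕ.+ 1) ℤ.+ q ℤ.* + n →
       (r r′ : ℕ) → r ℕ.≤ k → r′ ℕ.≤ w →
       prodEntry n (friezeMatrix (frieze k a) w i) (friezeMatrix (frieze w (galeCoeffs k a w)) k j) r r′ ≈ 0#
gale-orthogonal R k .(k ℕ.+ suc (suc w)) w P.refl a inE i j q i-j≡ r r′ r≤k r′≤w =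
  GaleDuality.Duality.Pairing.vanishes R k w a inE i j q i-j≡ r r′ r≤k r′≤w

-- The argument does not need k ≥ 1.
proposition4p6 : ∀ {c ℓ : Level} (R : CommutativeRing c ℓ) →
    let open CommutativeRing R
        open Frieze R
    in (k n : ℕ) → 1 ℕ.≤ k → k ℕ.+ 2 ℕ.≤ n →
       (a : Coeffs) → InE k n a →
       (i j : ℤ) → ∃ (λ q → i ℤ.- j ≡ + (n ∸ (k ℕ.+ 2) ℕ.+ 1) ℤ.+ q ℤ.* + n) →
       (r r' : ℕ) → r ℕ.≤ k → r' ℕ.≤ n ∸ (k ℕ.+ 2) →
       prodEntry n
         (friezeMatrix (frieze k a) (n ∸ (k ℕ.+ 2)) i)
         (friezeMatrix (frieze (n ∸ (k ℕ.+ 2)) (galeCoeffs k a (n ∸ (k ℕ.+ 2))))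
                       k j)
         r r'
       ≈ 0#
proposition4p6 R k n _ k+2≤n a inE i j (q , i-j≡) r r′ r≤k r′≤w =
  gale-orthogonal R k n (n ∸ (k ℕ.+ 2)) n≡ a inE i j q i-j≡ r r′ r≤k r′≤w
  where
  n≡ : n ≡ k ℕ.+ suc (suc (n ∸ (k ℕ.+ 2)))
  n≡ = P.trans (P.sym (ℕP.m+[n∸m]≡n k+2≤n)) (ℕP.+-assoc k 2 _)
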